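{- Let $M=(E,G)\in\mathcal E_3$ and let $H$ be a hyperplane of $G$. If $G\setminus H\not\subseteq E$, then $M$ is a doubling or a semidoubling of $M|H$.
   Context: A simple binary matroid (here just "matroid") is a pair $M=(E,G)$, where $G$ is identified with $\mathbb F_2^n\setminus\{0\}$ and $E\subseteq G$. A flat of $G$ is a set $V\setminus\{0\}$ with $V$ a subspace, of dimension $\dim V$; a hyperplane is a flat of dimension $n-1$; $M|H=(E\cap H,H)$. $\mathcal E_3$ is the class of matroids $(E,G)$ with $|E\cap F|$ even for every flat $F$ of dimension at least $3$. For a hyperplane $H$ of $G$: $M$ is a doubling of $M|H$ if there is $w\in G\setminus(H\cup E)$ with $E=(E\cap H)\cup\{w+x:x\in E\cap H\}$; $M$ is a semidoubling of $M|H$ if there are $w\in G\setminus(H\cup E)$ and a hyperplane $H_0$ of $H$ with $E=(E\cap H)\cup\{w+x: x\in (E\cap H)\,\triangle\,(H\setminus H_0)\}$ (i.e. for $x\in H_0$, $w+x\in E$ iff $x\in E$; for $x\in H\setminus H_0$, $w+x\in E$ iff $x\notin E$). -}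

module Defs where

open import Data.Bool using (Bool; true; false; _xor_; not)
open import Data.Nat using (ℕ; zero; suc; _≤_)
open import Data.Nat.Divisibility using (_∣_)
open import Data.List using (List; []; _∷_; _++_; map; filter; length)
open import Data.Vec using (Vec; []; _∷_; replicate; zipWith)
open import Data.Product using (Σ; ∃; _×_; _,_)
open import Data.Sum using (_⊎_)
open import Relation.Nullary using (¬_)
open import Relation.Binary.PropositionalEquality using (_≡_)
open import Function.Bundles using (_⇔_)

-- Vectors of F₂ⁿ, with F₂ = Bool (true = 1) and addition = xor.
Pt : ℕ → Set
Pt n = Vec Bool n

𝟎 : ∀ {n} → Pt n
𝟎 = replicate _ false

_⊕_ : ∀ {n} → Pt n → Pt n → Pt n
_⊕_ = zipWith _xor_

_∈G : ∀ {n} → Pt n → Set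
x ∈G = ¬ (x ≡ 𝟎)

comb : ∀ {n d} → Vec Bool d → Vec (Pt n) d → Pt n
comb [] [] = 𝟎
comb (true ∷ c) (v ∷ b) = v ⊕ comb c b
comb (false ∷ c) (v ∷ b) = comb c b

LinIndep : ∀ {n d} → Vec (Pt n) d → Set
LinIndep {d = d} b = ∀ c → comb c b ≡ 𝟎 → c ≡ replicate d false

-- A flat of G of dimension d: V ∖ {0} where V is the span of d linearly
-- independent vectors (i.e. V is a subspace of dimension d).
record Flat (n d : ℕ) : Set where
  field
    basis : Vec (Pt n) d
    indep : LinIndep basis

_∈F_ : ∀ {n d} → Pt n → Flat n d → Set
x ∈F F = (x ∈G) × (∃ λ c → comb c (Flat.basis F) ≡ x)

-- A simple binary matroid (E, G): E ⊆ G given by its characteristic function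
record Matroid (n : ℕ) : Set where
  field
    E    : Pt n → Bool
    E⊆G  : E 𝟎 ≡ false

_∈E_ : ∀ {n} → Pt n → Matroid n → Set
x ∈E M = Matroid.E M x ≡ true

allVecs : (d : ℕ) → List (Vec Bool d)
allVecs zero = [] ∷ []
allVecs (suc d) = map (true ∷_) (allVecs d) ++ map (false ∷_) (allVecs d)

countTrue : List Bool → ℕ
countTrue [] = 0
countTrue (true ∷ xs) = suc (countTrue xs)
countTrue (false ∷ xs) = countTrue xs

-- |E ∩ F| (the map c ↦ Σ cᵢbᵢ is a bijection F₂ᵈ → V, and 0 ∉ E)
|E∩F| : ∀ {n d} → Matroid n → Flat n d → ℕ
|E∩F| M F = countTrue (map (λ c → Matroid.E M (comb c (Flat.basis F))) (allVecs _))

∈𝓔₃ : ∀ {n} → Matroid n → Set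
∈𝓔₃ {n} M = ∀ (d : ℕ) → 3 ≤ d → (F : Flat n d) → 2 ∣ |E∩F| M F


IsDoubling : ∀ {d} → Matroid (suc d) → Flat (suc d) d → Set
IsDoubling {d} M H =
  Σ (Pt (suc d)) λ w → (w ∈G) × (¬ (w ∈F H)) × (¬ (w ∈E M)) ×
    (∀ y → (y ∈E M) ⇔ (((y ∈F H) × (y ∈E M))
                       ⊎ (∃ λ x → (x ∈F H) × (x ∈E M) × (y ≡ w ⊕ x))))

IsSemidoubling : ∀ {d} → Matroid (suc d) → Flat (suc d) d → Set
IsSemidoubling {d} M H =
  Σ (Pt (suc d)) λ w → (w ∈G) × (¬ (w ∈F H)) × (¬ (w ∈E M)) ×
  Σ ℕ λ d₀ → (suc d₀ ≡ d) × Σ (Flat (suc d) d₀) λ H₀ → (∀ x → x ∈F H₀ → x ∈F H) ×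
    (∀ y → (y ∈E M) ⇔ (((y ∈F H) × (y ∈E M))
       ⊎ (∃ λ x → (y ≡ w ⊕ x) ×
            ( (((x ∈F H) × (x ∈E M)) × ¬ ((x ∈F H) × ¬ (x ∈F H₀)))
            ⊎ (((x ∈F H) × ¬ (x ∈F H₀)) × ¬ ((x ∈F H) × (x ∈E M)))))))

-- Fix w ∉ H ∪ E and let flips x = [w + x ∈ E] + [x ∈ E] for x ∈ H ∪ {0}. When w, x, y are
-- independent, the 3-flat they span is ⟨x, y⟩ ∪ (w + ⟨x, y⟩), so |E ∩ ⟨w, x, y⟩| is even exactly
-- when flips (x + y) = flips x + flips y; in the degenerate cases this holds because 0, w ∉ E.
-- Hence flips is a linear form on H. If it vanishes, w + x ∈ E ⇔ x ∈ E on H and M is a doubling;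
-- otherwise its kernel is a hyperplane H₀ of H, membership flips exactly off H₀, and M is a
-- semidoubling. Every y lies in H or in w + H because the d + 1 independent vectors w, basis H span
-- F₂^(d+1), which follows from the pigeonhole principle.

module Submission where

open import Defs
open import Data.Nat using (ℕ; suc)
open import Data.Product using (∃; _×_)
open import Data.Sum using (_⊎_)
open import Relation.Nullary using (¬_)

open import Algebra.Bundles using (CommutativeRing)
open import Data.Bool using (Bool; true; false; _xor_; not; _∧_; _≟_)
open import Data.Bool.Properties
  using (xor-assoc; xor-identityˡ; xor-identityʳ; xor-same; xor-∧-commutativeRing;
         ∧-identityʳ; ∧-zeroʳ; ¬-not; not-involutive)
open import Data.Fin using (Fin; zero; suc) renaming (_≟_ to _≟ᶠ_)
open import Data.Fin.Properties using (any?; injective⇒≤; 2↔Bool; *↔×)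
open import Data.List using (List; []; _∷_; _++_; map; foldr)
open import Data.List.Properties using (map-++; map-∘)
open import Data.Nat using (zero; _*_; _^_; z≤n; s≤s)
open import Data.Nat.Divisibility using (_∣_; divides)
open import Data.Nat.Properties using (1+n≰n)
open import Data.Product using (_,_; proj₁; uncurry)
open import Data.Product.Function.NonDependent.Propositional using (_×-↔_)
open import Data.Sum using (inj₁; inj₂; [_,_]′; map₂)
open import Data.Vec using (Vec; []; _∷_; tail; uncons)
import Data.Vec as Vec
open import Data.Vec.Properties using (∷-injective; ≡-dec)
open import Data.Vec.Relation.Binary.Pointwise.Inductive
  using (Pointwise-≡⇒≡; zipWith-assoc; zipWith-identityˡ; zipWith-identityʳ)
open import Function using (_∘_)
open import Function.Bundles using (_⇔_; mk⇔; Equivalence; _↔_; Inverse; mk↔ₛ′; Injection)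
open import Function.Definitions using (Injective)
open import Function.Construct.Composition using (_⇔-∘_)
open import Function.Properties.Inverse using (↔-sym; ↔-trans; ↔⇒↣)
open import Relation.Binary.PropositionalEquality
open import Relation.Nullary using (Dec; yes; no; contradiction)
import Relation.Nullary.Decidable as Dec
open import Relation.Unary using (Decidable)

open import Algebra.Properties.CommutativeSemigroup
  (CommutativeRing.+-commutativeSemigroup xor-∧-commutativeRing)
  using () renaming (interchange to xor-interchange)

open ≡-Reasoning

-- Linear algebra over F₂

xor≡false⇒≡ : ∀ {a b} → a xor b ≡ false → a ≡ b
xor≡false⇒≡ {true}  {true}  _ = refl
xor≡false⇒≡ {false} {false} _ = refl

⊕-identityˡ : ∀ {n} (x : Pt n) → 𝟎 ⊕ x ≡ x
⊕-identityˡ x = Pointwise-≡⇒≡ (zipWith-identityˡ xor-identityˡ x)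

⊕-identityʳ : ∀ {n} (x : Pt n) → x ⊕ 𝟎 ≡ x
⊕-identityʳ x = Pointwise-≡⇒≡ (zipWith-identityʳ xor-identityʳ x)

⊕-assoc : ∀ {n} (x y z : Pt n) → (x ⊕ y) ⊕ z ≡ x ⊕ (y ⊕ z)
⊕-assoc x y z = Pointwise-≡⇒≡ (zipWith-assoc xor-assoc x y z)

⊕-self : ∀ {n} (x : Pt n) → x ⊕ x ≡ 𝟎
⊕-self [] = refl
⊕-self (a ∷ x) = cong₂ _∷_ (xor-same a) (⊕-self x)

⊕-interchange : ∀ {n} (x y u v : Pt n) → (x ⊕ y) ⊕ (u ⊕ v) ≡ (x ⊕ u) ⊕ (y ⊕ v)
⊕-interchange [] [] [] [] = refl
⊕-interchange (a ∷ x) (b ∷ y) (c ∷ u) (e ∷ v) =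
  cong₂ _∷_ (xor-interchange a b c e) (⊕-interchange x y u v)

⊕≡𝟎⇒≡ : ∀ {n} {x y : Pt n} → x ⊕ y ≡ 𝟎 → x ≡ y
⊕≡𝟎⇒≡ {x = x} {y} x⊕y≡𝟎 = begin
  x             ≡⟨ sym (⊕-identityʳ x) ⟩
  x ⊕ 𝟎         ≡⟨ cong (x ⊕_) (sym (⊕-self y)) ⟩
  x ⊕ (y ⊕ y)   ≡⟨ sym (⊕-assoc x y y) ⟩
  (x ⊕ y) ⊕ y   ≡⟨ cong (_⊕ y) x⊕y≡𝟎 ⟩
  𝟎 ⊕ y         ≡⟨ ⊕-identityˡ y ⟩
  y             ∎

Additive : ∀ {m n} → (Pt m → Pt n) → Set
Additive L = ∀ x y → L (x ⊕ y) ≡ L x ⊕ L y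

LinearForm : ∀ {n} → (Pt n → Bool) → Set
LinearForm ψ = ∀ x y → ψ (x ⊕ y) ≡ ψ x xor ψ y

additive-𝟎 : ∀ {m n} {L : Pt m → Pt n} → Additive L → L 𝟎 ≡ 𝟎
additive-𝟎 {L = L} L-add = begin
  L 𝟎          ≡⟨ cong L (sym (⊕-self 𝟎)) ⟩
  L (𝟎 ⊕ 𝟎)    ≡⟨ L-add 𝟎 𝟎 ⟩
  L 𝟎 ⊕ L 𝟎    ≡⟨ ⊕-self (L 𝟎) ⟩
  𝟎            ∎

linearForm-𝟎 : ∀ {n} {ψ : Pt n → Bool} → LinearForm ψ → ψ 𝟎 ≡ false
linearForm-𝟎 {ψ = ψ} ψ-lin = begin
  ψ 𝟎              ≡⟨ cong ψ (sym (⊕-self 𝟎)) ⟩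
  ψ (𝟎 ⊕ 𝟎)        ≡⟨ ψ-lin 𝟎 𝟎 ⟩
  ψ 𝟎 xor ψ 𝟎      ≡⟨ xor-same (ψ 𝟎) ⟩
  false            ∎

scale : ∀ {n} → Bool → Pt n → Pt n
scale true  v = v
scale false _ = 𝟎

scale-xor : ∀ {n} a b (v : Pt n) → scale (a xor b) v ≡ scale a v ⊕ scale b v
scale-xor true  true  v = sym (⊕-self v)
scale-xor true  false v = sym (⊕-identityʳ v)
scale-xor false b     v = sym (⊕-identityˡ (scale b v))

comb-∷ : ∀ {n k} a (c : Pt k) (v : Pt n) bs → comb (a ∷ c) (v ∷ bs) ≡ scale a v ⊕ comb c bs
comb-∷ true  c v bs = refl
comb-∷ false c v bs = sym (⊕-identityˡ (comb c bs))

comb-⊕ : ∀ {n k} (bs : Vec (Pt n) k) → Additive (λ c → comb c bs)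
comb-⊕ [] [] [] = sym (⊕-self 𝟎)
comb-⊕ (v ∷ bs) (a ∷ c) (a' ∷ c') = begin
  comb ((a xor a') ∷ (c ⊕ c')) (v ∷ bs)
    ≡⟨ comb-∷ (a xor a') (c ⊕ c') v bs ⟩
  scale (a xor a') v ⊕ comb (c ⊕ c') bs
    ≡⟨ cong₂ _⊕_ (scale-xor a a' v) (comb-⊕ bs c c') ⟩
  (scale a v ⊕ scale a' v) ⊕ (comb c bs ⊕ comb c' bs)
    ≡⟨ ⊕-interchange (scale a v) (scale a' v) (comb c bs) (comb c' bs) ⟩
  (scale a v ⊕ comb c bs) ⊕ (scale a' v ⊕ comb c' bs)
    ≡⟨ sym (cong₂ _⊕_ (comb-∷ a c v bs) (comb-∷ a' c' v bs)) ⟩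
  comb (a ∷ c) (v ∷ bs) ⊕ comb (a' ∷ c') (v ∷ bs) ∎

comb-map : ∀ {m n k} {L : Pt m → Pt n} → Additive L →
  (c : Pt k) (bs : Vec (Pt m) k) → comb c (Vec.map L bs) ≡ L (comb c bs)
comb-map L-add [] [] = sym (additive-𝟎 L-add)
comb-map {L = L} L-add (true ∷ c) (v ∷ bs) =
  trans (cong (L v ⊕_) (comb-map L-add c bs)) (sym (L-add v (comb c bs)))
comb-map L-add (false ∷ c) (v ∷ bs) = comb-map L-add c bs

comb-injective : ∀ {n k} {bs : Vec (Pt n) k} → LinIndep bs → Injective _≡_ _≡_ (λ c → comb c bs)
comb-injective {bs = bs} bs-indep {c} {c'} eq =
  ⊕≡𝟎⇒≡ (bs-indep (c ⊕ c') (trans (comb-⊕ bs c c') (trans (cong (_⊕ comb c' bs) eq) (⊕-self _))))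

map-independent : ∀ {m n k} {L : Pt m → Pt n} {bs : Vec (Pt m) k} → Additive L →
  (∀ {v} → L v ≡ 𝟎 → v ≡ 𝟎) → LinIndep bs → LinIndep (Vec.map L bs)
map-independent L-add L-ker bs-indep c eq =
  bs-indep c (L-ker (trans (sym (comb-map L-add c _)) eq))

∷-independent : ∀ {n k} {v : Pt n} {bs : Vec (Pt n) k} →
  LinIndep bs → (∀ c → comb c bs ≢ v) → LinIndep (v ∷ bs)
∷-independent bs-indep v∉⟨bs⟩ (true ∷ c) eq = contradiction (sym (⊕≡𝟎⇒≡ eq)) (v∉⟨bs⟩ c)
∷-independent bs-indep v∉⟨bs⟩ (false ∷ c) eq = cong (false ∷_) (bs-indep c eq)

pair-independent : ∀ {n} {x y : Pt n} → x ≢ 𝟎 → y ≢ 𝟎 → x ≢ y → LinIndep (x ∷ y ∷ [])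
pair-independent x≢𝟎 y≢𝟎 x≢y (false ∷ false ∷ []) _ = refl
pair-independent x≢𝟎 y≢𝟎 x≢y (false ∷ true ∷ []) eq = contradiction (trans (sym (⊕-identityʳ _)) eq) y≢𝟎
pair-independent x≢𝟎 y≢𝟎 x≢y (true ∷ false ∷ []) eq = contradiction (trans (sym (⊕-identityʳ _)) eq) x≢𝟎
pair-independent x≢𝟎 y≢𝟎 x≢y (true ∷ true ∷ []) eq = contradiction (trans (⊕≡𝟎⇒≡ eq) (⊕-identityʳ _)) x≢y

extendBasis : ∀ {n k} → Vec (Pt n) k → Vec (Pt (suc n)) (suc k)
extendBasis bs = (true ∷ 𝟎) ∷ Vec.map (false ∷_) bs

comb-extendBasis : ∀ {n k} a (c : Pt k) (bs : Vec (Pt n) k) → comb (a ∷ c) (extendBasis bs) ≡ a ∷ comb c bs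
comb-extendBasis true c bs = begin
  (true ∷ 𝟎) ⊕ comb c (Vec.map (false ∷_) bs)   ≡⟨ cong ((true ∷ 𝟎) ⊕_) (comb-map (λ _ _ → refl) c bs) ⟩
  true ∷ (𝟎 ⊕ comb c bs)                        ≡⟨ cong (true ∷_) (⊕-identityˡ (comb c bs)) ⟩
  true ∷ comb c bs                              ∎
comb-extendBasis false c bs = comb-map (λ _ _ → refl) c bs

standardBasis : ∀ n → Vec (Pt n) n
standardBasis zero = []
standardBasis (suc n) = extendBasis (standardBasis n)

comb-standardBasis : ∀ {n} (c : Pt n) → comb c (standardBasis n) ≡ c
comb-standardBasis [] = refl
comb-standardBasis (a ∷ c) = trans (comb-extendBasis a c _) (cong (a ∷_) (comb-standardBasis c))

-- Pt n is finite

Pt↔Fin : ∀ n → Pt n ↔ Fin (2 ^ n)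
Pt↔Fin zero = mk↔ₛ′ (λ _ → zero) (λ _ → []) (λ { zero → refl }) (λ { [] → refl })
Pt↔Fin (suc n) = ↔-trans uncons↔ (↔-trans (↔-sym 2↔Bool ×-↔ Pt↔Fin n) (↔-sym *↔×))
  where
  uncons↔ : Pt (suc n) ↔ (Bool × Pt n)
  uncons↔ = mk↔ₛ′ uncons (uncurry _∷_) (λ _ → refl) (λ { (_ ∷ _) → refl })

Fin-injective⇒surjective : ∀ {n} {h : Fin n → Fin n} → Injective _≡_ _≡_ h → ∀ j → ∃ λ i → h i ≡ j
Fin-injective⇒surjective {n} {h} h-inj j with any? (λ i → h i ≟ᶠ j)
... | yes hit = hit
... | no miss = contradiction (injective⇒≤ h⁺-inj) 1+n≰n
  where
  h⁺ : Fin (suc n) → Fin n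
  h⁺ zero = j
  h⁺ (suc i) = h i
  h⁺-inj : Injective _≡_ _≡_ h⁺
  h⁺-inj {zero}  {zero}  _  = refl
  h⁺-inj {zero}  {suc i} eq = contradiction (i , sym eq) miss
  h⁺-inj {suc i} {zero}  eq = contradiction (i , eq) miss
  h⁺-inj {suc i} {suc i'} eq = cong suc (h-inj eq)

module _ {n : ℕ} where
  open Inverse (Pt↔Fin n)

  ∃?-Pt : ∀ {P : Pt n → Set} → Decidable P → Dec (∃ P)
  ∃?-Pt {P} P? = Dec.map′ (λ (i , p) → from i , p)
    (λ (x , p) → to x , subst P (sym (strictlyInverseʳ x)) p) (any? (P? ∘ from))

  Pt-injective⇒surjective : ∀ {f : Pt n → Pt n} → Injective _≡_ _≡_ f → ∀ y → ∃ λ x → f x ≡ y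
  Pt-injective⇒surjective {f} f-inj y =
    let i , eq = Fin-injective⇒surjective (from-inj ∘ f-inj ∘ to-inj) (to y) in from i , to-inj eq
    where
    to-inj : Injective _≡_ _≡_ to
    to-inj = Injection.injective (↔⇒↣ (Pt↔Fin n))
    from-inj : Injective _≡_ _≡_ from
    from-inj = Injection.injective (↔⇒↣ (↔-sym (Pt↔Fin n)))

independent⇒spanning : ∀ {n} {bs : Vec (Pt n) n} → LinIndep bs → ∀ y → ∃ λ c → comb c bs ≡ y
independent⇒spanning bs-indep = Pt-injective⇒surjective (comb-injective bs-indep)

-- Kernels of linear forms

record KernelBasis {n} (ψ : Pt n → Bool) : Set where
  field
    dim         : ℕ
    codim-1     : suc dim ≡ n
    basis       : Vec (Pt n) dim
    independent : LinIndep basis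
    span⊆kernel : ∀ c → ψ (comb c basis) ≡ false
    kernel⊆span : ∀ v → ψ v ≡ false → ∃ λ c → comb c basis ≡ v

module _ {n} (ψ : Pt (suc n) → Bool) (ψ-lin : LinearForm ψ) where

  private
    ψ' : Pt n → Bool
    ψ' c = ψ (false ∷ c)

  linearForm-∷ : ∀ a c → ψ (a ∷ c) ≡ (a ∧ ψ (true ∷ 𝟎)) xor ψ' c
  linearForm-∷ true c = begin
    ψ (true ∷ c)                    ≡⟨ cong (ψ ∘ (true ∷_)) (sym (⊕-identityˡ c)) ⟩
    ψ ((true ∷ 𝟎) ⊕ (false ∷ c))    ≡⟨ ψ-lin (true ∷ 𝟎) (false ∷ c) ⟩
    ψ (true ∷ 𝟎) xor ψ' c           ∎
  linearForm-∷ false c = refl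

  linearForm-∷-ignoresHead : ψ (true ∷ 𝟎) ≡ false → ∀ a c → ψ (a ∷ c) ≡ ψ' c
  linearForm-∷-ignoresHead ψe₀ a c = begin
    ψ (a ∷ c)                      ≡⟨ linearForm-∷ a c ⟩
    (a ∧ ψ (true ∷ 𝟎)) xor ψ' c    ≡⟨ cong (λ t → (a ∧ t) xor ψ' c) ψe₀ ⟩
    (a ∧ false) xor ψ' c           ≡⟨ cong (_xor ψ' c) (∧-zeroʳ a) ⟩
    ψ' c                           ∎

  pivotKernelBasis : ψ (true ∷ 𝟎) ≡ true → KernelBasis ψ
  pivotKernelBasis ψe₀ = record
    { dim = n ; codim-1 = refl ; basis = basis ; independent = independent
    ; span⊆kernel = span⊆kernel ; kernel⊆span = kernel⊆span }
    where
    ψ-∷ : ∀ a c → ψ (a ∷ c) ≡ a xor ψ' c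
    ψ-∷ a c = begin
      ψ (a ∷ c)                      ≡⟨ linearForm-∷ a c ⟩
      (a ∧ ψ (true ∷ 𝟎)) xor ψ' c    ≡⟨ cong (λ t → (a ∧ t) xor ψ' c) ψe₀ ⟩
      (a ∧ true) xor ψ' c            ≡⟨ cong (_xor ψ' c) (∧-identityʳ a) ⟩
      a xor ψ' c                     ∎
    lift : Pt n → Pt (suc n)
    lift c = ψ' c ∷ c
    basis : Vec (Pt (suc n)) n
    basis = Vec.map lift (standardBasis n)
    comb-basis : ∀ c → comb c basis ≡ lift c
    comb-basis c = trans (comb-map (λ x y → cong (_∷ (x ⊕ y)) (ψ-lin (false ∷ x) (false ∷ y))) c _)
                         (cong lift (comb-standardBasis c))
    independent : LinIndep basis
    independent c eq = cong tail (trans (sym (comb-basis c)) eq)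
    span⊆kernel : ∀ c → ψ (comb c basis) ≡ false
    span⊆kernel c = trans (cong ψ (comb-basis c)) (trans (ψ-∷ (ψ' c) c) (xor-same (ψ' c)))
    kernel⊆span : ∀ v → ψ v ≡ false → ∃ λ c → comb c basis ≡ v
    kernel⊆span (a ∷ c) ψv =
      c , trans (comb-basis c) (cong (_∷ c) (sym (xor≡false⇒≡ (trans (sym (ψ-∷ a c)) ψv))))

  extendKernelBasis : ψ (true ∷ 𝟎) ≡ false → KernelBasis ψ' → KernelBasis ψ
  extendKernelBasis ψe₀ K = record
    { dim = suc K.dim ; codim-1 = cong suc K.codim-1 ; basis = extendBasis K.basis
    ; independent = independent ; span⊆kernel = span⊆kernel ; kernel⊆span = kernel⊆span }
    where
    module K = KernelBasis K
    ψ-∷ : ∀ a c → ψ (a ∷ c) ≡ ψ' c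
    ψ-∷ = linearForm-∷-ignoresHead ψe₀
    independent : LinIndep (extendBasis K.basis)
    independent (a ∷ c) eq =
      let a≡false , comb≡𝟎 = ∷-injective (trans (sym (comb-extendBasis a c K.basis)) eq)
      in cong₂ _∷_ a≡false (K.independent c comb≡𝟎)
    span⊆kernel : ∀ c → ψ (comb c (extendBasis K.basis)) ≡ false
    span⊆kernel (a ∷ c) = begin
      ψ (comb (a ∷ c) (extendBasis K.basis))  ≡⟨ cong ψ (comb-extendBasis a c K.basis) ⟩
      ψ (a ∷ comb c K.basis)             ≡⟨ ψ-∷ a (comb c K.basis) ⟩
      ψ' (comb c K.basis)                ≡⟨ K.span⊆kernel c ⟩
      false                              ∎
    kernel⊆span : ∀ v → ψ v ≡ false → ∃ λ c → comb c (extendBasis K.basis) ≡ v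
    kernel⊆span (a ∷ v) ψv =
      let c , eq = K.kernel⊆span v (trans (sym (ψ-∷ a v)) ψv)
      in a ∷ c , trans (comb-extendBasis a c K.basis) (cong (a ∷_) eq)

kernelBasis : ∀ {n} {ψ : Pt n → Bool} → LinearForm ψ → ∀ {v} → ψ v ≡ true → KernelBasis ψ
kernelBasis {zero} {ψ} ψ-lin {[]} ψv = contradiction (trans (sym (linearForm-𝟎 {ψ = ψ} ψ-lin)) ψv) λ ()
kernelBasis {suc n} {ψ} ψ-lin {a ∷ v} ψv with ψ (true ∷ 𝟎) in ψe₀
... | true  = pivotKernelBasis ψ ψ-lin ψe₀
... | false = extendKernelBasis ψ ψ-lin ψe₀ (kernelBasis (λ x y → ψ-lin (false ∷ x) (false ∷ y))
                (trans (sym (linearForm-∷-ignoresHead ψ ψ-lin ψe₀ a v)) ψv))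

-- Parity

xorAll : List Bool → Bool
xorAll = foldr _xor_ false

isOdd : ℕ → Bool
isOdd zero = false
isOdd (suc n) = not (isOdd n)

isOdd-countTrue : ∀ l → isOdd (countTrue l) ≡ xorAll l
isOdd-countTrue [] = refl
isOdd-countTrue (true ∷ l) = cong not (isOdd-countTrue l)
isOdd-countTrue (false ∷ l) = isOdd-countTrue l

isOdd-*2 : ∀ q → isOdd (q * 2) ≡ false
isOdd-*2 zero = refl
isOdd-*2 (suc q) = trans (not-involutive (isOdd (q * 2))) (isOdd-*2 q)

even⇒xorAll≡false : ∀ l → 2 ∣ countTrue l → xorAll l ≡ false
even⇒xorAll≡false l (divides q eq) = begin
  xorAll l                ≡⟨ sym (isOdd-countTrue l) ⟩
  isOdd (countTrue l)     ≡⟨ cong isOdd eq ⟩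
  isOdd (q * 2)           ≡⟨ isOdd-*2 q ⟩
  false                   ∎

xorAll-++ : ∀ l l' → xorAll (l ++ l') ≡ xorAll l xor xorAll l'
xorAll-++ [] l' = refl
xorAll-++ (a ∷ l) l' = trans (cong (a xor_) (xorAll-++ l l')) (sym (xor-assoc a (xorAll l) (xorAll l')))

xorAll-map-xor : ∀ {A : Set} (f g : A → Bool) l →
  xorAll (map (λ x → f x xor g x) l) ≡ xorAll (map f l) xor xorAll (map g l)
xorAll-map-xor f g [] = refl
xorAll-map-xor f g (x ∷ l) =
  trans (cong ((f x xor g x) xor_) (xorAll-map-xor f g l))
        (xor-interchange (f x) (g x) (xorAll (map f l)) (xorAll (map g l)))

xorAll-span-∷ : ∀ {n k} (f : Pt n → Bool) (w : Pt n) (bs : Vec (Pt n) k) →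
  xorAll (map (λ c → f (comb c (w ∷ bs))) (allVecs (suc k)))
    ≡ xorAll (map (λ c → f (w ⊕ comb c bs) xor f (comb c bs)) (allVecs k))
xorAll-span-∷ {k = k} f w bs = begin
  xorAll (map F (map (true ∷_) A ++ map (false ∷_) A))
    ≡⟨ cong xorAll (map-++ F (map (true ∷_) A) (map (false ∷_) A)) ⟩
  xorAll (map F (map (true ∷_) A) ++ map F (map (false ∷_) A))
    ≡⟨ xorAll-++ (map F (map (true ∷_) A)) (map F (map (false ∷_) A)) ⟩
  xorAll (map F (map (true ∷_) A)) xor xorAll (map F (map (false ∷_) A))
    ≡⟨ sym (cong₂ (λ l l' → xorAll l xor xorAll l') (map-∘ A) (map-∘ A)) ⟩
  xorAll (map (F ∘ (true ∷_)) A) xor xorAll (map (F ∘ (false ∷_)) A)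
    ≡⟨ sym (xorAll-map-xor (F ∘ (true ∷_)) (F ∘ (false ∷_)) A) ⟩
  xorAll (map (λ c → f (w ⊕ comb c bs) xor f (comb c bs)) A) ∎
  where
  F : Pt (suc k) → Bool
  F c = f (comb c (w ∷ bs))
  A : List (Pt k)
  A = allVecs k

-- The coset structure of E over a hyperplane H

-- The semidoubling clause of IsSemidoubling, read with X = x ∈ H, A = x ∈ H₀, a = flips x, e = [x ∈ E].
xor≡true⇔⊎ : ∀ {X A : Set} a e → X → (A ⇔ a ≡ false) →
  (a xor e ≡ true) ⇔ (((X × e ≡ true) × ¬ (X × ¬ A)) ⊎ ((X × ¬ A) × ¬ (X × e ≡ true)))
xor≡true⇔⊎ false true  x A⇔ = mk⇔
  (λ _ → inj₁ ((x , refl) , λ (_ , ¬A) → ¬A (Equivalence.from A⇔ refl)))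
  (λ _ → refl)
xor≡true⇔⊎ false false x A⇔ = mk⇔ (λ ())
  [ (λ { ((_ , ()) , _) })
  , (λ ((_ , ¬A) , _) → contradiction (Equivalence.from A⇔ refl) ¬A) ]′
xor≡true⇔⊎ true  true  x A⇔ = mk⇔ (λ ())
  [ (λ (_ , ¬¬A) → contradiction (x , λ A → contradiction (Equivalence.to A⇔ A) λ ()) ¬¬A)
  , (λ (_ , ¬e) → contradiction (x , refl) ¬e) ]′
xor≡true⇔⊎ true  false x A⇔ = mk⇔
  (λ _ → inj₂ ((x , λ A → contradiction (Equivalence.to A⇔ A) λ ()) , λ { (_ , ()) }))
  (λ _ → refl)

module CosetStructure {d} (M : Matroid (suc d)) (H : Flat (suc d) d) (M∈𝓔₃ : ∈𝓔₃ M)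
  {w : Pt (suc d)} (w∈G : w ∈G) (w∉H : ¬ (w ∈F H)) (w∉E : ¬ (w ∈E M)) where

  open Matroid M using (E; E⊆G)
  open Flat H using () renaming (basis to b; indep to b-independent)

  pt : Pt d → Pt (suc d)
  pt c = comb c b

  flips : Pt (suc d) → Bool
  flips x = E (w ⊕ x) xor E x

  φ : Pt d → Bool
  φ = flips ∘ pt

  E-w : E w ≡ false
  E-w = ¬-not w∉E

  flips-𝟎 : flips 𝟎 ≡ false
  flips-𝟎 = cong₂ _xor_ (trans (cong E (⊕-identityʳ w)) E-w) E⊆G

  E-coset : ∀ x → E (w ⊕ x) ≡ flips x xor E x
  E-coset x = sym (begin
    (E (w ⊕ x) xor E x) xor E x   ≡⟨ xor-assoc (E (w ⊕ x)) (E x) (E x) ⟩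
    E (w ⊕ x) xor (E x xor E x)   ≡⟨ cong (E (w ⊕ x) xor_) (xor-same (E x)) ⟩
    E (w ⊕ x) xor false           ≡⟨ xor-identityʳ (E (w ⊕ x)) ⟩
    E (w ⊕ x)                     ∎)

  ∈E⇒∈G : ∀ {y} → y ∈E M → y ∈G
  ∈E⇒∈G y∈E refl = contradiction (trans (sym E⊆G) y∈E) λ ()

  pt-additive : Additive pt
  pt-additive = comb-⊕ b

  pt-injective : Injective _≡_ _≡_ pt
  pt-injective = comb-injective b-independent

  w∉span : ∀ c → pt c ≢ w
  w∉span c eq = w∉H (w∈G , c , eq)

  flips-additive-on-flat : ∀ {x y} → LinIndep (x ∷ y ∷ []) → (∀ c → comb c (x ∷ y ∷ []) ≢ w) →
    flips (x ⊕ y) ≡ flips x xor flips y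
  flips-additive-on-flat {x} {y} xy-independent w∉⟨x,y⟩ = xor≡false⇒≡ (begin
    flips (x ⊕ y) xor (flips x xor flips y)
      ≡⟨ cong (λ t → flips (x ⊕ y) xor (flips x xor t)) (xor-identityʳ (flips y)) ⟨
    flips (x ⊕ y) xor (flips x xor (flips y xor false))
      ≡⟨ cong (λ t → flips (x ⊕ y) xor (flips x xor (flips y xor (t xor false)))) flips-𝟎 ⟨
    flips (x ⊕ y) xor (flips x xor (flips y xor (flips 𝟎 xor false)))
      ≡⟨ cong₂ (λ p q → flips (x ⊕ q) xor (flips p xor (flips q xor (flips 𝟎 xor false))))
               (⊕-identityʳ x) (⊕-identityʳ y) ⟨
    xorAll (map (λ c → flips (comb c (x ∷ y ∷ []))) (allVecs 2))
      ≡⟨ xorAll-span-∷ E w (x ∷ y ∷ []) ⟨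
    xorAll (map (λ c → E (comb c (w ∷ x ∷ y ∷ []))) (allVecs 3))
      ≡⟨ even⇒xorAll≡false (map (λ c → E (comb c (w ∷ x ∷ y ∷ []))) (allVecs 3))
                           (M∈𝓔₃ 3 (s≤s (s≤s (s≤s z≤n))) F) ⟩
    false ∎)
    where
    F : Flat (suc d) 3
    F = record { basis = w ∷ x ∷ y ∷ [] ; indep = ∷-independent xy-independent w∉⟨x,y⟩ }

  flips-additive : ∀ x y → (∀ c → comb c (x ∷ y ∷ []) ≢ w) → flips (x ⊕ y) ≡ flips x xor flips y
  flips-additive x y w∉⟨x,y⟩ with ≡-dec _≟_ x 𝟎 | ≡-dec _≟_ y 𝟎 | ≡-dec _≟_ x y
  ... | yes refl | _ | _ = trans (cong flips (⊕-identityˡ y)) (cong (_xor flips y) (sym flips-𝟎))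
  ... | no _ | yes refl | _ = begin
    flips (x ⊕ 𝟎)          ≡⟨ cong flips (⊕-identityʳ x) ⟩
    flips x                ≡⟨ xor-identityʳ (flips x) ⟨
    flips x xor false      ≡⟨ cong (flips x xor_) flips-𝟎 ⟨
    flips x xor flips 𝟎    ∎
  ... | no _ | no _ | yes refl = begin
    flips (x ⊕ x)          ≡⟨ cong flips (⊕-self x) ⟩
    flips 𝟎                ≡⟨ flips-𝟎 ⟩
    false                  ≡⟨ xor-same (flips x) ⟨
    flips x xor flips x    ∎
  ... | no x≢𝟎 | no y≢𝟎 | no x≢y = flips-additive-on-flat (pair-independent x≢𝟎 y≢𝟎 x≢y) w∉⟨x,y⟩

  φ-linear : LinearForm φ
  φ-linear c c' = begin
    flips (pt (c ⊕ c'))          ≡⟨ cong flips (pt-additive c c') ⟩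
    flips (pt c ⊕ pt c')         ≡⟨ flips-additive (pt c) (pt c') w∉⟨c,c'⟩ ⟩
    flips (pt c) xor flips (pt c') ∎
    where
    w∉⟨c,c'⟩ : ∀ a → comb a (pt c ∷ pt c' ∷ []) ≢ w
    w∉⟨c,c'⟩ a = w∉span (comb a (c ∷ c' ∷ [])) ∘ trans (sym (comb-map pt-additive a (c ∷ c' ∷ [])))

  cover : ∀ y → (∃ λ c → pt c ≡ y) ⊎ (∃ λ c → w ⊕ pt c ≡ y)
  cover y = byHead (independent⇒spanning (∷-independent b-independent w∉span) y)
    where
    byHead : (∃ λ c → comb c (w ∷ b) ≡ y) → (∃ λ c → pt c ≡ y) ⊎ (∃ λ c → w ⊕ pt c ≡ y)
    byHead (true  ∷ c , eq) = inj₂ (c , eq)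
    byHead (false ∷ c , eq) = inj₁ (c , eq)

  CosetSplit : (Pt (suc d) → Set) → Pt (suc d) → Set
  CosetSplit Cond y = ((y ∈F H) × (y ∈E M)) ⊎ (∃ λ x → (y ≡ w ⊕ x) × Cond x)

  coset-decomposition : (Cond : Pt (suc d) → Set) → (∀ {x} → Cond x → x ∈F H) →
    (∀ c → pt c ∈G → (w ⊕ pt c) ∈E M ⇔ Cond (pt c)) →
    ∀ y → y ∈E M ⇔ CosetSplit Cond y
  coset-decomposition Cond Cond⇒∈H cond y = mk⇔ (to y) (from y)
    where
    to : ∀ y → y ∈E M → CosetSplit Cond y
    to y y∈E = [ inH y∈E , inCoset y∈E ]′ (cover y)
      where
      inH : ∀ {y} → y ∈E M → (∃ λ c → pt c ≡ y) → CosetSplit Cond y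
      inH y∈E (c , refl) = inj₁ ((∈E⇒∈G y∈E , c , refl) , y∈E)
      inCoset : ∀ {y} → y ∈E M → (∃ λ c → w ⊕ pt c ≡ y) → CosetSplit Cond y
      inCoset y∈E (c , refl) = inj₂ (pt c , refl , Equivalence.to (cond c pt-c∈G) y∈E)
        where
        pt-c∈G : pt c ∈G
        pt-c∈G pt-c≡𝟎 = w∉E (subst (_∈E M) (trans (cong (w ⊕_) pt-c≡𝟎) (⊕-identityʳ w)) y∈E)
    from : ∀ y → CosetSplit Cond y → y ∈E M
    from y (inj₁ (_ , y∈E)) = y∈E
    from _ (inj₂ (x , refl , x-cond)) with Cond⇒∈H x-cond
    ... | x∈G , c , refl = Equivalence.from (cond c x∈G) x-cond

  doubling : (∀ c → φ c ≡ false) → IsDoubling M H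
  doubling φ≡0 = w , w∈G , w∉H , w∉E , λ y → reorder ⇔-∘ coset-decomposition Cond proj₁ cond y
    where
    Cond : Pt (suc d) → Set
    Cond x = (x ∈F H) × (x ∈E M)
    E-w⊕ : ∀ c → E (w ⊕ pt c) ≡ E (pt c)
    E-w⊕ c = trans (E-coset (pt c)) (cong (_xor E (pt c)) (φ≡0 c))
    cond : ∀ c → pt c ∈G → (w ⊕ pt c) ∈E M ⇔ Cond (pt c)
    cond c pt-c∈G = mk⇔ (λ e → (pt-c∈G , c , refl) , trans (sym (E-w⊕ c)) e) (λ (_ , e) → trans (E-w⊕ c) e)
    reorder : ∀ {y} → CosetSplit Cond y ⇔ (((y ∈F H) × (y ∈E M)) ⊎ (∃ λ x → (x ∈F H) × (x ∈E M) × (y ≡ w ⊕ x)))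
    reorder = mk⇔ (map₂ λ (x , eq , x∈H , x∈E) → x , x∈H , x∈E , eq)
                  (map₂ λ (x , x∈H , x∈E , eq) → x , eq , x∈H , x∈E)

  semidoubling : ∀ c₁ → φ c₁ ≡ true → IsSemidoubling M H
  semidoubling c₁ φc₁ =
    w , w∈G , w∉H , w∉E , K.dim , K.codim-1 , H₀ , H₀⊆H , coset-decomposition Cond Cond⇒∈H cond
    where
    K : KernelBasis φ
    K = kernelBasis φ-linear {c₁} φc₁
    module K = KernelBasis K
    H₀ : Flat (suc d) K.dim
    H₀ = record { basis = Vec.map pt K.basis
                ; indep = map-independent pt-additive (b-independent _) K.independent }
    H₀⊆H : ∀ x → x ∈F H₀ → x ∈F H
    H₀⊆H x (x∈G , c , eq) = x∈G , comb c K.basis , trans (sym (comb-map pt-additive c K.basis)) eq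
    ∈H₀⇔ : ∀ c → pt c ∈G → pt c ∈F H₀ ⇔ φ c ≡ false
    ∈H₀⇔ c pt-c∈G = mk⇔ to from
      where
      to : pt c ∈F H₀ → φ c ≡ false
      to (_ , c₀ , eq) = subst (λ c' → φ c' ≡ false) c₀≡c (K.span⊆kernel c₀)
        where
        c₀≡c : comb c₀ K.basis ≡ c
        c₀≡c = pt-injective {comb c₀ K.basis} {c} (trans (sym (comb-map pt-additive c₀ K.basis)) eq)
      from : φ c ≡ false → pt c ∈F H₀
      from φc = let c₀ , eq = K.kernel⊆span c φc
                in pt-c∈G , c₀ , trans (comb-map pt-additive c₀ K.basis) (cong pt eq)
    Cond : Pt (suc d) → Set
    Cond x = (((x ∈F H) × (x ∈E M)) × ¬ ((x ∈F H) × ¬ (x ∈F H₀)))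
           ⊎ (((x ∈F H) × ¬ (x ∈F H₀)) × ¬ ((x ∈F H) × (x ∈E M)))
    Cond⇒∈H : ∀ {x} → Cond x → x ∈F H
    Cond⇒∈H = [ proj₁ ∘ proj₁ , proj₁ ∘ proj₁ ]′
    cond : ∀ c → pt c ∈G → (w ⊕ pt c) ∈E M ⇔ Cond (pt c)
    cond c pt-c∈G = xor≡true⇔⊎ (φ c) (E (pt c)) (pt-c∈G , c , refl) (∈H₀⇔ c pt-c∈G)
      ⇔-∘ mk⇔ (trans (sym (E-coset (pt c)))) (trans (E-coset (pt c)))

corollary3p3 : ∀ {d : ℕ} (M : Matroid (suc d)) (H : Flat (suc d) d) →
    ∈𝓔₃ M → (∃ λ x → (x ∈G) × (¬ (x ∈F H)) × (¬ (x ∈E M))) →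
    IsDoubling M H ⊎ IsSemidoubling M H
corollary3p3 M H M∈𝓔₃ (w , w∈G , w∉H , w∉E) = dichotomy (∃?-Pt (λ c → φ c ≟ true))
  where
  open CosetStructure M H M∈𝓔₃ w∈G w∉H w∉E
  dichotomy : Dec (∃ λ c → φ c ≡ true) → IsDoubling M H ⊎ IsSemidoubling M H
  dichotomy (yes (c , φc≡true)) = inj₂ (semidoubling c φc≡true)
  dichotomy (no ∄c) = inj₁ (doubling λ c → ¬-not (∄c ∘ (c ,_)))
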